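{- For every nonnegative integer $n$, $$\sum_{k=0}^n\binom{2k}k\binom{n+k}{2k}(-9)^{n-k}a_k =\sum_{k=0}^n\binom{2k}k^2\binom{4k}{2k}\binom{n+3k}{4k}(-27)^{n-k},$$ where $a_k=\sum_{j=0}^k\binom kj^2\binom{2j}j$. -}

module Defs where

open import Data.Nat using (ℕ; zero; suc)
import Data.Nat
open import Data.Nat.Combinatorics using (_C_)
open import Data.Integer using (ℤ; +_; -_; _+_; _*_; _^_)

sumTo : ℕ → (ℕ → ℤ) → ℤ
sumTo zero    f = f 0
sumTo (suc n) f = sumTo n f + f (suc n)

binom : ℕ → ℕ → ℤ
binom n k = + (n C k)

a : ℕ → ℤ
a k = sumTo k (λ j → binom k j * binom k j * binom (2 Data.Nat.* j) j)

-- Both sides satisfy the recurrence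
--   81 (n+1)³ S(n) + (14n³ + 63n² + 97n + 51) S(n+1) + (n+2)³ S(n+2) = 0
-- and agree for n = 0 and n = 1, so they agree for all n.  Each side is proved to satisfy it by
-- creative telescoping: its summand F(n,k) obeys c₀ F(n,k) + c₁ F(n+1,k) + c₂ F(n+2,k) = G(n,k+1) − G(n,k)
-- for an explicit certificate G, and the sum over k telescopes.  On the left the summand contains a_k and the
-- certificate identity holds only modulo (k+1)² a_{k+1} = (10k² + 10k + 3) a_k − 9k² a_{k−1}, which is itself
-- proved by creative telescoping.  Each certificate identity becomes a polynomial identity once all its terms
-- are written, via the ratio relations of binomial coefficients, as multiples of a single hypergeometric term.

module Submission where

open import Defs
open import Data.Nat using (ℕ; _∸_)
import Data.Nat
open import Data.Integer using (ℤ; +_; -_; _*_; _^_)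
open import Relation.Binary.PropositionalEquality using (_≡_)

open import Data.Nat as ℕ using (zero; suc; _<_)
import Data.Nat.Properties as ℕ
import Data.Nat.Tactic.RingSolver as ℕ-Solver
open import Data.Nat.Combinatorics using (_C_; nCk+nC[k+1]≡[n+1]C[k+1]; nC1≡n)
open import Data.Nat.Combinatorics.Specification using (k>n⇒nCk≡0)
open import Data.Integer using (_+_; _-_; 0ℤ; NonZero)
import Data.Integer.Properties as ℤ
open import Data.Integer.Tactic.RingSolver using (solve-∀)
open import Relation.Binary.PropositionalEquality
  using (refl; sym; trans; cong; cong₂; subst; module ≡-Reasoning)

open import Data.Product using (_×_; _,_; proj₁)
open import Relation.Nullary using (yes; no)
open import Algebra.Properties.CommutativeSemigroup ℤ.*-commutativeSemigroup
  using (x∙yz≈y∙xz; xy∙z≈y∙xz; x∙yz≈yx∙z; xy∙z≈xz∙y)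

open ≡-Reasoning

[k+1]*[n+1]C[k+1]≡[n+1]*nCk : ∀ n k → suc k ℕ.* (suc n C suc k) ≡ suc n ℕ.* (n C k)
[k+1]*[n+1]C[k+1]≡[n+1]*nCk zero    zero    = refl
[k+1]*[n+1]C[k+1]≡[n+1]*nCk zero    (suc k) = ℕ.*-zeroʳ (suc (suc k))
[k+1]*[n+1]C[k+1]≡[n+1]*nCk (suc n) zero    =
  trans (ℕ.*-identityˡ _) (trans (nC1≡n (suc (suc n))) (sym (ℕ.*-identityʳ _)))
[k+1]*[n+1]C[k+1]≡[n+1]*nCk (suc n) (suc k) = begin
  suc (suc k) ℕ.* (suc (suc n) C suc (suc k))
    ≡⟨ cong (suc (suc k) ℕ.*_) (nCk+nC[k+1]≡[n+1]C[k+1] (suc n) (suc k)) ⟨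
  suc (suc k) ℕ.* (suc n C suc k ℕ.+ suc n C suc (suc k))
    ≡⟨ regroup (suc n C suc k) k (suc n C suc (suc k)) ⟩
  suc n C suc k ℕ.+ (suc k ℕ.* (suc n C suc k) ℕ.+ suc (suc k) ℕ.* (suc n C suc (suc k)))
    ≡⟨ cong₂ (λ u v → suc n C suc k ℕ.+ (u ℕ.+ v))
         ([k+1]*[n+1]C[k+1]≡[n+1]*nCk n k) ([k+1]*[n+1]C[k+1]≡[n+1]*nCk n (suc k)) ⟩
  suc n C suc k ℕ.+ (suc n ℕ.* (n C k) ℕ.+ suc n ℕ.* (n C suc k))
    ≡⟨ cong (suc n C suc k ℕ.+_) (ℕ.*-distribˡ-+ (suc n) (n C k) (n C suc k)) ⟨
  suc n C suc k ℕ.+ suc n ℕ.* (n C k ℕ.+ n C suc k)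
    ≡⟨ cong (λ u → suc n C suc k ℕ.+ suc n ℕ.* u) (nCk+nC[k+1]≡[n+1]C[k+1] n k) ⟩
  suc (suc n) ℕ.* (suc n C suc k) ∎
  where
  regroup : ∀ c k d → suc (suc k) ℕ.* (c ℕ.+ d) ≡ c ℕ.+ (suc k ℕ.* c ℕ.+ suc (suc k) ℕ.* d)
  regroup = ℕ-Solver.solve-∀

[n+1]*nCk+k*[n+1]Ck≡[n+1]*[n+1]Ck : ∀ n k → suc n ℕ.* (n C k) ℕ.+ k ℕ.* (suc n C k) ≡ suc n ℕ.* (suc n C k)
[n+1]*nCk+k*[n+1]Ck≡[n+1]*[n+1]Ck n zero    = ℕ.+-identityʳ _
[n+1]*nCk+k*[n+1]Ck≡[n+1]*[n+1]Ck n (suc k) = begin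
  suc n ℕ.* (n C suc k) ℕ.+ suc k ℕ.* (suc n C suc k)
    ≡⟨ cong (suc n ℕ.* (n C suc k) ℕ.+_) ([k+1]*[n+1]C[k+1]≡[n+1]*nCk n k) ⟩
  suc n ℕ.* (n C suc k) ℕ.+ suc n ℕ.* (n C k)
    ≡⟨ ℕ.*-distribˡ-+ (suc n) (n C suc k) (n C k) ⟨
  suc n ℕ.* (n C suc k ℕ.+ n C k)
    ≡⟨ cong (suc n ℕ.*_) (trans (ℕ.+-comm (n C suc k) (n C k)) (nCk+nC[k+1]≡[n+1]C[k+1] n k)) ⟩
  suc n ℕ.* (suc n C suc k) ∎

-- A record rather than the bare equation p * x ≡ q * y: ℤ's _*_ unfolds eagerly, so unification
-- could not recover the four factors from the equation.
infix 4 _·_≐_·_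

record _·_≐_·_ (p x q y : ℤ) : Set where
  constructor proportional
  field equation : p * x ≡ q * y

open _·_≐_·_

≐-refl : ∀ {p x} → p · x ≐ p · x
≐-refl = proportional refl

≐-coeff : ∀ {p p′ q q′ x y} → p ≡ p′ → q ≡ q′ → p · x ≐ q · y → p′ · x ≐ q′ · y
≐-coeff refl refl px≐qy = px≐qy

≐-trans : ∀ {p q r s x y z} → p · x ≐ q · y → r · y ≐ s · z → r * p · x ≐ q * s · z
≐-trans {p} {q} {r} {s} {x} {y} {z} (proportional px≡qy) (proportional ry≡sz) = proportional (begin
  r * p * x   ≡⟨ ℤ.*-assoc r p x ⟩
  r * (p * x) ≡⟨ cong (r *_) px≡qy ⟩
  r * (q * y) ≡⟨ x∙yz≈y∙xz r q y ⟩
  q * (r * y) ≡⟨ cong (q *_) ry≡sz ⟩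
  q * (s * z) ≡⟨ ℤ.*-assoc q s z ⟨
  q * s * z   ∎)

≐-scale : ∀ {p q x y} c → p · x ≐ q · y → p * c · x ≐ q * c · y
≐-scale {p} {q} {x} {y} c (proportional px≡qy) = proportional (begin
  p * c * x   ≡⟨ xy∙z≈y∙xz p c x ⟩
  c * (p * x) ≡⟨ cong (c *_) px≡qy ⟩
  c * (q * y) ≡⟨ x∙yz≈yx∙z c q y ⟩
  q * c * y   ∎)

≐-* : ∀ {p q r s x y u v} → p · x ≐ q · y → r · u ≐ s · v → p * r · x * u ≐ q * s · y * v
≐-* {p} {q} {r} {s} {x} {y} {u} {v} (proportional px≡qy) (proportional ru≡sv) = proportional (begin
  p * r * (x * u)     ≡⟨ interchange p r x u ⟩
  (p * x) * (r * u)   ≡⟨ cong₂ _*_ px≡qy ru≡sv ⟩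
  (q * y) * (s * v)   ≡⟨ interchange q y s v ⟩
  q * s * (y * v)     ∎)
  where
  interchange : ∀ a b c d → a * b * (c * d) ≡ (a * c) * (b * d)
  interchange = solve-∀

≐-*ˡ : ∀ {p q x y} g → p · x ≐ q · y → p · g * x ≐ g * q · y
≐-*ˡ {p} {q} {x} {y} g (proportional px≡qy) = proportional (begin
  p * (g * x) ≡⟨ x∙yz≈y∙xz p g x ⟩
  g * (p * x) ≡⟨ cong (g *_) px≡qy ⟩
  g * (q * y) ≡⟨ ℤ.*-assoc g q y ⟨
  g * q * y   ∎)

≐-*ʳ : ∀ {p q x y} a → p · x ≐ q · y → p · x * a ≐ q * a · y
≐-*ʳ {p} {q} {x} {y} a (proportional px≡qy) = proportional (begin
  p * (x * a) ≡⟨ ℤ.*-assoc p x a ⟨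
  p * x * a   ≡⟨ cong (_* a) px≡qy ⟩
  q * y * a   ≡⟨ xy∙z≈xz∙y q y a ⟩
  q * a * y   ∎)

≐-cancel : ∀ m .{{_ : NonZero m}} {p q x y} → m * p · x ≐ m * q · y → p · x ≐ q · y
≐-cancel m {p} {q} {x} {y} (proportional mpx≡mqy) = proportional (ℤ.*-cancelˡ-≡ m (p * x) (q * y) (begin
  m * (p * x) ≡⟨ ℤ.*-assoc m p x ⟨
  m * p * x   ≡⟨ mpx≡mqy ⟩
  m * q * y   ≡⟨ ℤ.*-assoc m q y ⟩
  m * (q * y) ∎))

combination-via-proportions :
  ∀ {d x₀ x₁ x₂ y₀ y₁ q₀ q₁ q₂ r₀ r₁ t} .{{_ : NonZero d}} (c₀ c₁ c₂ : ℤ) →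
  d · x₀ ≐ q₀ · t → d · x₁ ≐ q₁ · t → d · x₂ ≐ q₂ · t →
  d · y₀ ≐ r₀ · t → d · y₁ ≐ r₁ · t →
  c₀ * q₀ + c₁ * q₁ + c₂ * q₂ ≡ r₁ - r₀ →
  c₀ * x₀ + c₁ * x₁ + c₂ * x₂ ≡ y₁ - y₀
combination-via-proportions {d} {x₀} {x₁} {x₂} {y₀} {y₁} {q₀} {q₁} {q₂} {r₀} {r₁} {t} c₀ c₁ c₂
  (proportional dx₀) (proportional dx₁) (proportional dx₂) (proportional dy₀) (proportional dy₁) identity =
  ℤ.*-cancelˡ-≡ d _ _ (begin
    d * (c₀ * x₀ + c₁ * x₁ + c₂ * x₂)             ≡⟨ distribute d c₀ c₁ c₂ x₀ x₁ x₂ ⟩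
    c₀ * (d * x₀) + c₁ * (d * x₁) + c₂ * (d * x₂)
      ≡⟨ cong₂ _+_ (cong₂ _+_ (cong (c₀ *_) dx₀) (cong (c₁ *_) dx₁)) (cong (c₂ *_) dx₂) ⟩
    c₀ * (q₀ * t) + c₁ * (q₁ * t) + c₂ * (q₂ * t) ≡⟨ factor c₀ c₁ c₂ q₀ q₁ q₂ t ⟩
    (c₀ * q₀ + c₁ * q₁ + c₂ * q₂) * t             ≡⟨ cong (_* t) identity ⟩
    (r₁ - r₀) * t                                 ≡⟨ distribute-minus r₁ r₀ t ⟩
    r₁ * t - r₀ * t                               ≡⟨ cong₂ _-_ dy₁ dy₀ ⟨
    d * y₁ - d * y₀                               ≡⟨ distribute-minus′ d y₁ y₀ ⟨
    d * (y₁ - y₀)                                 ∎)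
  where
  distribute : ∀ d c₀ c₁ c₂ x₀ x₁ x₂ →
               d * (c₀ * x₀ + c₁ * x₁ + c₂ * x₂) ≡ c₀ * (d * x₀) + c₁ * (d * x₁) + c₂ * (d * x₂)
  distribute = solve-∀
  factor : ∀ c₀ c₁ c₂ q₀ q₁ q₂ t →
           c₀ * (q₀ * t) + c₁ * (q₁ * t) + c₂ * (q₂ * t) ≡ (c₀ * q₀ + c₁ * q₁ + c₂ * q₂) * t
  factor = solve-∀
  distribute-minus : ∀ r₁ r₀ t → (r₁ - r₀) * t ≡ r₁ * t - r₀ * t
  distribute-minus = solve-∀
  distribute-minus′ : ∀ d y₁ y₀ → d * (y₁ - y₀) ≡ d * y₁ - d * y₀
  distribute-minus′ = solve-∀

pos-+-* : ∀ n p k → + (n ℕ.+ p ℕ.* k) ≡ + n + + p * + k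
pos-+-* n p k = trans (ℤ.pos-+ n (p ℕ.* k)) (cong (λ t → + n + t) (ℤ.pos-* p k))

binom-vanish : ∀ {m r} → m < r → binom m r ≡ 0ℤ
binom-vanish m<r = cong +_ (k>n⇒nCk≡0 m<r)

binom-absorption : ∀ m r → + suc r · binom (suc m) (suc r) ≐ + suc m · binom m r
binom-absorption m r = proportional (begin
  + suc r * binom (suc m) (suc r) ≡⟨ ℤ.pos-* (suc r) (suc m C suc r) ⟨
  + (suc r ℕ.* (suc m C suc r))  ≡⟨ cong +_ ([k+1]*[n+1]C[k+1]≡[n+1]*nCk m r) ⟩
  + (suc m ℕ.* (m C r))          ≡⟨ ℤ.pos-* (suc m) (m C r) ⟩
  + suc m * binom m r            ∎)

binom-upper : ∀ m r → (+ suc m - + r) · binom (suc m) r ≐ + suc m · binom m r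
binom-upper m r = proportional (begin
  (+ suc m - + r) * binom (suc m) r                                   ≡⟨ expand (+ suc m) (+ r) _ ⟩
  + suc m * binom (suc m) r - + r * binom (suc m) r                   ≡⟨ cong (_- + r * binom (suc m) r) lifted ⟨
  + suc m * binom m r + + r * binom (suc m) r - + r * binom (suc m) r ≡⟨ cancel (+ suc m * binom m r) _ ⟩
  + suc m * binom m r                                                 ∎)
  where
  expand : ∀ s t b → (s - t) * b ≡ s * b - t * b
  expand = solve-∀
  cancel : ∀ a b → a + b - b ≡ a
  cancel = solve-∀
  lifted : + suc m * binom m r + + r * binom (suc m) r ≡ + suc m * binom (suc m) r
  lifted = begin
    + suc m * binom m r + + r * binom (suc m) r
      ≡⟨ cong₂ _+_ (ℤ.pos-* (suc m) (m C r)) (ℤ.pos-* r (suc m C r)) ⟨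
    + (suc m ℕ.* (m C r)) + + (r ℕ.* (suc m C r))
      ≡⟨ ℤ.pos-+ (suc m ℕ.* (m C r)) (r ℕ.* (suc m C r)) ⟨
    + (suc m ℕ.* (m C r) ℕ.+ r ℕ.* (suc m C r))
      ≡⟨ cong +_ ([n+1]*nCk+k*[n+1]Ck≡[n+1]*[n+1]Ck m r) ⟩
    + (suc m ℕ.* (suc m C r))
      ≡⟨ ℤ.pos-* (suc m) (suc m C r) ⟩
    + suc m * binom (suc m) r ∎

central-binom : ℕ → ℤ
central-binom k = binom (2 ℕ.* k) k

2[1+2k]≢0 : ∀ k → NonZero (+ 2 * (+ 1 + + 2 * + k))
2[1+2k]≢0 k = subst NonZero (cong (λ t → + 2 * (+ 1 + t)) (ℤ.pos-* 2 k)) _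

central-binom-step : ∀ k → (+ 1 + + k) · central-binom (suc k) ≐ + 2 * (+ 1 + + 2 * + k) · central-binom k
central-binom-step k = proportional (ℤ.*-cancelˡ-≡ (+ suc k) _ _ (begin
  + suc k * (+ suc k * binom (2 ℕ.* suc k) (suc k))
    ≡⟨ cong (λ t → + suc k * (+ suc k * binom t (suc k))) (ℕ.*-suc 2 k) ⟩
  + suc k * (+ suc k * binom (suc (suc m)) (suc k))
    ≡⟨ cong (+ suc k *_) (equation (binom-absorption (suc m) k)) ⟩
  + suc k * (+ suc (suc m) * binom (suc m) k)
    ≡⟨ x∙yz≈y∙xz (+ suc k) (+ suc (suc m)) _ ⟩
  + suc (suc m) * (+ suc k * binom (suc m) k)
    ≡⟨ cong (λ t → + suc (suc m) * (t * binom (suc m) k)) [1+2k]-k≡1+k ⟨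
  + suc (suc m) * ((+ suc m - + k) * binom (suc m) k)
    ≡⟨ cong (+ suc (suc m) *_) (equation (binom-upper m k)) ⟩
  + suc (suc m) * (+ suc m * binom m k)
    ≡⟨ cong (λ t → (+ 2 + t) * ((+ 1 + t) * binom m k)) (ℤ.pos-* 2 k) ⟩
  (+ 2 + + 2 * + k) * ((+ 1 + + 2 * + k) * binom m k)
    ≡⟨ regroup (+ k) (binom m k) ⟩
  + suc k * (+ 2 * (+ 1 + + 2 * + k) * binom m k) ∎))
  where
  m : ℕ
  m = 2 ℕ.* k
  regroup : ∀ k b → (+ 2 + + 2 * k) * ((+ 1 + + 2 * k) * b) ≡ (+ 1 + k) * (+ 2 * (+ 1 + + 2 * k) * b)
  regroup = solve-∀
  [1+2k]-k≡1+k : + suc m - + k ≡ + suc k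
  [1+2k]-k≡1+k = trans (cong (λ t → + 1 + t - + k) (ℤ.pos-* 2 k)) (simplify (+ k))
    where
    simplify : ∀ k → + 1 + + 2 * k - k ≡ + 1 + k
    simplify = solve-∀

rising : ℤ → ℕ → ℤ
rising x zero    = + 1
rising x (suc s) = rising x s * (+ suc s + x)

binom-absorption-iterated : ∀ s m r → rising (+ r) s · binom (s ℕ.+ m) (s ℕ.+ r) ≐ rising (+ m) s · binom m r
binom-absorption-iterated zero    m r = ≐-refl
binom-absorption-iterated (suc s) m r = proportional (begin
  rising (+ r) s * + suc (s ℕ.+ r) * binom (suc (s ℕ.+ m)) (suc (s ℕ.+ r))
    ≡⟨ ℤ.*-assoc (rising (+ r) s) _ _ ⟩
  rising (+ r) s * (+ suc (s ℕ.+ r) * binom (suc (s ℕ.+ m)) (suc (s ℕ.+ r)))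
    ≡⟨ cong (rising (+ r) s *_) (equation (binom-absorption (s ℕ.+ m) (s ℕ.+ r))) ⟩
  rising (+ r) s * (+ suc (s ℕ.+ m) * binom (s ℕ.+ m) (s ℕ.+ r))
    ≡⟨ x∙yz≈y∙xz (rising (+ r) s) (+ suc (s ℕ.+ m)) _ ⟩
  + suc (s ℕ.+ m) * (rising (+ r) s * binom (s ℕ.+ m) (s ℕ.+ r))
    ≡⟨ cong (+ suc (s ℕ.+ m) *_) (equation (binom-absorption-iterated s m r)) ⟩
  + suc (s ℕ.+ m) * (rising (+ m) s * binom m r)
    ≡⟨ x∙yz≈yx∙z (+ suc (s ℕ.+ m)) (rising (+ m) s) _ ⟩
  rising (+ m) s * + suc (s ℕ.+ m) * binom m r ∎)

binom-step₄₂ : ∀ m r → (+ 1 + + r) * (+ 2 + + r) * ((+ 1 + + m - + r) * (+ 2 + + m - + r))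
                       · binom (4 ℕ.+ m) (2 ℕ.+ r)
                     ≐ rising (+ m) 4 · binom m r
binom-step₄₂ m r = ≐-coeff (factor (+ r) (+ m)) (rising-shift (+ m))
  (≐-trans (binom-absorption-iterated 2 (2 ℕ.+ m) r)
           (≐-trans (binom-upper (suc m) r) (binom-upper m r)))
  where
  factor : ∀ r m → (+ 1 + m - r) * (+ 2 + m - r) * (+ 1 * (+ 1 + r) * (+ 2 + r))
                 ≡ (+ 1 + r) * (+ 2 + r) * ((+ 1 + m - r) * (+ 2 + m - r))
  factor = solve-∀
  rising-shift : ∀ m → + 1 * (+ 1 + (+ 2 + m)) * (+ 2 + (+ 2 + m)) * ((+ 2 + m) * (+ 1 + m))
                     ≡ + 1 * (+ 1 + m) * (+ 2 + m) * (+ 3 + m) * (+ 4 + m)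
  rising-shift = solve-∀

sumTo-cong : ∀ n {f g : ℕ → ℤ} → (∀ k → f k ≡ g k) → sumTo n f ≡ sumTo n g
sumTo-cong zero    f≗g = f≗g 0
sumTo-cong (suc n) f≗g = cong₂ _+_ (sumTo-cong n f≗g) (f≗g (suc n))

sumTo-+ : ∀ n (f g : ℕ → ℤ) → sumTo n (λ k → f k + g k) ≡ sumTo n f + sumTo n g
sumTo-+ zero    f g = refl
sumTo-+ (suc n) f g = trans (cong (_+ (f (suc n) + g (suc n))) (sumTo-+ n f g))
                             (interchange (sumTo n f) (sumTo n g) (f (suc n)) (g (suc n)))
  where
  interchange : ∀ a b c d → a + b + (c + d) ≡ a + c + (b + d)
  interchange = solve-∀

sumTo-*ˡ : ∀ n c (f : ℕ → ℤ) → sumTo n (λ k → c * f k) ≡ c * sumTo n f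
sumTo-*ˡ zero    c f = refl
sumTo-*ˡ (suc n) c f = trans (cong (_+ c * f (suc n)) (sumTo-*ˡ n c f)) (sym (ℤ.*-distribˡ-+ c _ _))

sumTo-telescope : ∀ n (g : ℕ → ℤ) → sumTo n (λ k → g (suc k) - g k) ≡ g (suc n) - g 0
sumTo-telescope zero    g = refl
sumTo-telescope (suc n) g = trans (cong (_+ (g (suc (suc n)) - g (suc n))) (sumTo-telescope n g))
  (trans (ℤ.+-comm (g (suc n) - g 0) _) (ℤ.+-minus-telescope (g (suc (suc n))) (g (suc n)) (g 0)))

sumTo-extend : ∀ n (f : ℕ → ℤ) → f (suc n) ≡ 0ℤ → sumTo (suc n) f ≡ sumTo n f
sumTo-extend n f f[1+n]≡0 = trans (cong (λ x → sumTo n f + x) f[1+n]≡0) (ℤ.+-identityʳ _)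

Annihilates : (c₀ c₁ c₂ : ℕ → ℤ) → (ℕ → ℤ) → Set
Annihilates c₀ c₁ c₂ u = ∀ n → c₀ n * u n + c₁ n * u (suc n) + c₂ n * u (suc (suc n)) ≡ 0ℤ

creative-telescoping :
  ∀ (c₀ c₁ c₂ : ℕ → ℤ) (F G : ℕ → ℕ → ℤ) →
  (∀ {n k} → n < k → F n k ≡ 0ℤ) →
  (∀ n → G n 0 ≡ 0ℤ) →
  (∀ n → G n (3 ℕ.+ n) ≡ 0ℤ) →
  (∀ n k → c₀ n * F n k + c₁ n * F (suc n) k + c₂ n * F (suc (suc n)) k ≡ G n (suc k) - G n k) →
  Annihilates c₀ c₁ c₂ (λ n → sumTo n (F n))
creative-telescoping c₀ c₁ c₂ F G F-vanish G-start G-end certificate n = begin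
  c₀ n * S n + c₁ n * S (suc n) + c₂ n * S (suc (suc n))
    ≡⟨ cong₂ (λ u v → c₀ n * u + c₁ n * v + c₂ n * S (suc (suc n))) extend₀ extend₁ ⟨
  c₀ n * Σ (F n) + c₁ n * Σ (F (suc n)) + c₂ n * Σ (F (suc (suc n)))
    ≡⟨ linear ⟨
  Σ (λ k → c₀ n * F n k + c₁ n * F (suc n) k + c₂ n * F (suc (suc n)) k)
    ≡⟨ sumTo-cong (2 ℕ.+ n) (certificate n) ⟩
  Σ (λ k → G n (suc k) - G n k)
    ≡⟨ sumTo-telescope (2 ℕ.+ n) (G n) ⟩
  G n (3 ℕ.+ n) - G n 0
    ≡⟨ cong₂ _-_ (G-end n) (G-start n) ⟩
  0ℤ ∎
  where
  Σ : (ℕ → ℤ) → ℤ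
  Σ = sumTo (2 ℕ.+ n)
  S : ℕ → ℤ
  S m = sumTo m (F m)
  extend₁ : Σ (F (suc n)) ≡ S (suc n)
  extend₁ = sumTo-extend (suc n) (F (suc n)) (F-vanish (ℕ.n<1+n (suc n)))
  extend₀ : Σ (F n) ≡ S n
  extend₀ = trans (sumTo-extend (suc n) (F n) (F-vanish (ℕ.m<n⇒m<1+n (ℕ.n<1+n n))))
                  (sumTo-extend n (F n) (F-vanish (ℕ.n<1+n n)))
  linear : Σ (λ k → c₀ n * F n k + c₁ n * F (suc n) k + c₂ n * F (suc (suc n)) k)
         ≡ c₀ n * Σ (F n) + c₁ n * Σ (F (suc n)) + c₂ n * Σ (F (suc (suc n)))
  linear = begin
    Σ (λ k → c₀ n * F n k + c₁ n * F (suc n) k + c₂ n * F (suc (suc n)) k)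
      ≡⟨ sumTo-+ (2 ℕ.+ n) _ _ ⟩
    Σ (λ k → c₀ n * F n k + c₁ n * F (suc n) k) + Σ (λ k → c₂ n * F (suc (suc n)) k)
      ≡⟨ cong (_+ Σ (λ k → c₂ n * F (suc (suc n)) k)) (sumTo-+ (2 ℕ.+ n) _ _) ⟩
    Σ (λ k → c₀ n * F n k) + Σ (λ k → c₁ n * F (suc n) k) + Σ (λ k → c₂ n * F (suc (suc n)) k)
      ≡⟨ cong₂ _+_ (cong₂ _+_ (sumTo-*ˡ (2 ℕ.+ n) (c₀ n) (F n)) (sumTo-*ˡ (2 ℕ.+ n) (c₁ n) (F (suc n))))
                   (sumTo-*ˡ (2 ℕ.+ n) (c₂ n) (F (suc (suc n)))) ⟩
    c₀ n * Σ (F n) + c₁ n * Σ (F (suc n)) + c₂ n * Σ (F (suc (suc n))) ∎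

annihilated-unique :
  ∀ (c₀ c₁ c₂ : ℕ → ℤ) (u v : ℕ → ℤ) → (∀ n → NonZero (c₂ n)) →
  Annihilates c₀ c₁ c₂ u → Annihilates c₀ c₁ c₂ v → u 0 ≡ v 0 → u 1 ≡ v 1 →
  ∀ n → u n ≡ v n
annihilated-unique c₀ c₁ c₂ u v c₂≢0 Lu Lv u₀≡v₀ u₁≡v₁ n = proj₁ (agree n)
  where
  solve-last : ∀ a b c → a + b + c ≡ 0ℤ → c ≡ - (a + b)
  solve-last a b c eq = trans (isolate a b c) (trans (cong (_- (a + b)) eq) (ℤ.+-identityˡ _))
    where
    isolate : ∀ a b c → c ≡ a + b + c - (a + b)
    isolate = solve-∀
  agree : ∀ n → u n ≡ v n × u (suc n) ≡ v (suc n)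
  agree zero    = u₀≡v₀ , u₁≡v₁
  agree (suc n) with agree n
  ... | uₙ≡vₙ , u₁₊ₙ≡v₁₊ₙ = u₁₊ₙ≡v₁₊ₙ , ℤ.*-cancelˡ-≡ (c₂ n) _ _ {{c₂≢0 n}} (begin
    c₂ n * u (suc (suc n))            ≡⟨ solve-last (c₀ n * u n) _ _ (Lu n) ⟩
    - (c₀ n * u n + c₁ n * u (suc n)) ≡⟨ cong₂ (λ x y → - (c₀ n * x + c₁ n * y)) uₙ≡vₙ u₁₊ₙ≡v₁₊ₙ ⟩
    - (c₀ n * v n + c₁ n * v (suc n)) ≡⟨ solve-last (c₀ n * v n) _ _ (Lv n) ⟨
    c₂ n * v (suc (suc n))            ∎)

term : (ℕ → ℤ) → ℕ → ℤ → ℕ → ℕ → ℤ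
term c p x n k = c k * binom (n ℕ.+ p ℕ.* k) (suc p ℕ.* k) * x ^ (n ∸ k)

module _ (c : ℕ → ℤ) (p : ℕ) (x : ℤ) where

  term-vanish : ∀ {n k} → n < k → term c p x n k ≡ 0ℤ
  term-vanish {n} {k} n<k = begin
    c k * binom (n ℕ.+ p ℕ.* k) (suc p ℕ.* k) * x ^ (n ∸ k)
      ≡⟨ cong (λ b → c k * b * x ^ (n ∸ k)) (binom-vanish (ℕ.+-monoˡ-< (p ℕ.* k) n<k)) ⟩
    c k * 0ℤ * x ^ (n ∸ k)
      ≡⟨ cong (_* x ^ (n ∸ k)) (ℤ.*-zeroʳ (c k)) ⟩
    0ℤ * x ^ (n ∸ k)
      ≡⟨ ℤ.*-zeroˡ (x ^ (n ∸ k)) ⟩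
    0ℤ ∎

  -- For k > n the exponent suc n ∸ k is truncated, but then the binomial coefficient vanishes.
  binom-*-pow-suc∸ : ∀ n k → binom (n ℕ.+ p ℕ.* k) (suc p ℕ.* k) * x ^ (suc n ∸ k)
                            ≡ binom (n ℕ.+ p ℕ.* k) (suc p ℕ.* k) * (x * x ^ (n ∸ k))
  binom-*-pow-suc∸ n k with k ℕ.≤? n
  ... | yes k≤n = cong (λ e → binom (n ℕ.+ p ℕ.* k) (suc p ℕ.* k) * x ^ e) (ℕ.+-∸-assoc 1 k≤n)
  ... | no  k≰n = trans (cong (_* x ^ (suc n ∸ k)) B≡0) (sym (cong (_* (x * x ^ (n ∸ k))) B≡0))
    where
    B≡0 : binom (n ℕ.+ p ℕ.* k) (suc p ℕ.* k) ≡ 0ℤ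
    B≡0 = binom-vanish (ℕ.+-monoˡ-< (p ℕ.* k) (ℕ.≰⇒> k≰n))

  term-shiftₙ : ∀ n k → x * (+ 1 + + n + + p * + k) · term c p x n k ≐ (+ suc n - + k) · term c p x (suc n) k
  term-shiftₙ n k = proportional (sym (begin
    (+ suc n - + k) * (c k * binom (suc m) r * x ^ (suc n ∸ k))
      ≡⟨ regroup₁ (+ suc n - + k) (c k) _ _ ⟩
    c k * ((+ suc n - + k) * binom (suc m) r) * x ^ (suc n ∸ k)
      ≡⟨ cong (λ t → c k * (t * binom (suc m) r) * x ^ (suc n ∸ k)) cast ⟩
    c k * ((+ suc m - + r) * binom (suc m) r) * x ^ (suc n ∸ k)
      ≡⟨ cong (λ t → c k * t * x ^ (suc n ∸ k)) (equation (binom-upper m r)) ⟩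
    c k * (+ suc m * binom m r) * x ^ (suc n ∸ k)
      ≡⟨ regroup₂ (c k) (+ suc m) _ _ ⟩
    + suc m * c k * (binom m r * x ^ (suc n ∸ k))
      ≡⟨ cong (+ suc m * c k *_) (binom-*-pow-suc∸ n k) ⟩
    + suc m * c k * (binom m r * (x * x ^ (n ∸ k)))
      ≡⟨ cong (λ t → (+ 1 + t) * c k * (binom m r * (x * x ^ (n ∸ k)))) (pos-+-* n p k) ⟩
    (+ 1 + (+ n + + p * + k)) * c k * (binom m r * (x * x ^ (n ∸ k)))
      ≡⟨ regroup₃ (+ n) (+ p) (+ k) x (c k) _ _ ⟩
    x * (+ 1 + + n + + p * + k) * (c k * binom m r * x ^ (n ∸ k)) ∎))
    where
    m r : ℕ
    m = n ℕ.+ p ℕ.* k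
    r = suc p ℕ.* k
    regroup₁ : ∀ a c b q → a * (c * b * q) ≡ c * (a * b) * q
    regroup₁ = solve-∀
    regroup₂ : ∀ c a b q → c * (a * b) * q ≡ a * c * (b * q)
    regroup₂ = solve-∀
    regroup₃ : ∀ n p k x c b q → (+ 1 + (n + p * k)) * c * (b * (x * q)) ≡ x * (+ 1 + n + p * k) * (c * b * q)
    regroup₃ = solve-∀
    cast : + suc n - + k ≡ + suc m - + r
    cast = begin
      + suc n - + k                                 ≡⟨ simplify (+ n) (+ p) (+ k) ⟩
      + 1 + (+ n + + p * + k) - (+ 1 + + p) * + k
        ≡⟨ cong₂ (λ s t → + 1 + s - t) (pos-+-* n p k) (ℤ.pos-* (suc p) k) ⟨
      + suc m - + r                                 ∎
      where
      simplify : ∀ n p k → + 1 + n - k ≡ + 1 + (n + p * k) - (+ 1 + p) * k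
      simplify = solve-∀

  term-shift-diag : ∀ {α β} n k → α · c (suc k) ≐ β · c k →
                    rising (+ suc p * + k) (suc p) * α · term c p x (suc n) (suc k)
                      ≐ β * rising (+ n + + p * + k) (suc p) · term c p x n k
  term-shift-diag {α} {β} n k (proportional αc′≡βc) = proportional (begin
    rising (+ suc p * + k) (suc p) * α * (c (suc k) * binom (suc n ℕ.+ p ℕ.* suc k) (suc p ℕ.* suc k) * x ^ (n ∸ k))
      ≡⟨ cong₂ (λ R B → R * α * (c (suc k) * B * x ^ (n ∸ k)))
           (cong (λ t → rising t (suc p)) (sym (ℤ.pos-* (suc p) k)))
           (cong₂ binom (shift-upper n p k) (ℕ.*-suc (suc p) k)) ⟩
    rising (+ r) (suc p) * α * (c (suc k) * binom (suc p ℕ.+ m) (suc p ℕ.+ r) * x ^ (n ∸ k))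
      ≡⟨ regroup α (rising (+ r) (suc p)) (c (suc k)) (binom (suc p ℕ.+ m) (suc p ℕ.+ r)) (x ^ (n ∸ k)) ⟩
    α * c (suc k) * (rising (+ r) (suc p) * binom (suc p ℕ.+ m) (suc p ℕ.+ r)) * x ^ (n ∸ k)
      ≡⟨ cong₂ (λ u v → u * v * x ^ (n ∸ k)) αc′≡βc (equation (binom-absorption-iterated (suc p) m r)) ⟩
    β * c k * (rising (+ m) (suc p) * binom m r) * x ^ (n ∸ k)
      ≡⟨ regroup⁻¹ β _ _ _ _ ⟩
    β * rising (+ m) (suc p) * (c k * binom m r * x ^ (n ∸ k))
      ≡⟨ cong (λ t → β * rising t (suc p) * term c p x n k) (pos-+-* n p k) ⟩
    β * rising (+ n + + p * + k) (suc p) * term c p x n k ∎)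
    where
    m r : ℕ
    m = n ℕ.+ p ℕ.* k
    r = suc p ℕ.* k
    shift-upper : ∀ n p k → suc n ℕ.+ p ℕ.* suc k ≡ suc p ℕ.+ (n ℕ.+ p ℕ.* k)
    shift-upper = ℕ-Solver.solve-∀
    regroup : ∀ a R c B q → R * a * (c * B * q) ≡ a * c * (R * B) * q
    regroup = solve-∀
    regroup⁻¹ : ∀ a R c B q → a * c * (R * B) * q ≡ a * R * (c * B * q)
    regroup⁻¹ = solve-∀

a-summand : ℕ → ℕ → ℤ
a-summand k j = binom k j * binom k j * binom (2 ℕ.* j) j

a-summand-shiftₖ : ∀ k j → (+ 1 + + k) * (+ 1 + + k) · a-summand k j
                         ≐ (+ 1 + + k - + j) * (+ 1 + + k - + j) · a-summand (suc k) j
a-summand-shiftₖ k j = proportional (begin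
  s * s * (binom k j * binom k j * c)               ≡⟨ square s (binom k j) c ⟩
  (s * binom k j) * (s * binom k j) * c             ≡⟨ cong (λ u → u * u * c) (equation (binom-upper k j)) ⟨
  (t * binom (suc k) j) * (t * binom (suc k) j) * c ≡⟨ square t (binom (suc k) j) c ⟨
  t * t * (binom (suc k) j * binom (suc k) j * c)   ∎)
  where
  s t c : ℤ
  s = + 1 + + k
  t = + 1 + + k - + j
  c = binom (2 ℕ.* j) j
  square : ∀ s b c → s * s * (b * b * c) ≡ (s * b) * (s * b) * c
  square = solve-∀

a-summand-shift-diag : ∀ k j → (+ 1 + + j) * (+ 1 + + j) * (+ 1 + + j) · a-summand (suc k) (suc j)
                             ≐ + 2 * (+ 1 + + 2 * + j) * ((+ 1 + + k) * (+ 1 + + k)) · a-summand k j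
a-summand-shift-diag k j = proportional (begin
  s * s * s * (b′ * b′ * c′)                  ≡⟨ cube s b′ c′ ⟩
  (s * b′) * (s * b′) * (s * c′)
    ≡⟨ cong₂ (λ u v → u * u * v) (equation (binom-absorption k j)) (equation (central-binom-step j)) ⟩
  (r * binom k j) * (r * binom k j) * (m * c) ≡⟨ cube⁻¹ m r (binom k j) c ⟩
  m * (r * r) * (binom k j * binom k j * c)   ∎)
  where
  s r m b′ c′ c : ℤ
  s = + 1 + + j
  r = + 1 + + k
  m = + 2 * (+ 1 + + 2 * + j)
  b′ = binom (suc k) (suc j)
  c′ = binom (2 ℕ.* suc j) (suc j)
  c = binom (2 ℕ.* j) j
  cube : ∀ s b c → s * s * s * (b * b * c) ≡ (s * b) * (s * b) * (s * c)
  cube = solve-∀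
  cube⁻¹ : ∀ m r b c → (r * b) * (r * b) * (m * c) ≡ m * (r * r) * (b * b * c)
  cube⁻¹ = solve-∀

a-certificate : ℕ → ℕ → ℤ
a-certificate k zero    = 0ℤ
a-certificate k (suc j) = + 2 * (+ 1 + + 2 * + j) * (+ 3 * + j - + 4 * + k - + 5) * a-summand (suc k) j

a-certificate-ratio : ∀ k j → (+ 2 + + k) * (+ 2 + + k) · a-certificate k j
                            ≐ + j * + j * + j * (+ 3 * + j - + 4 * + k - + 8) · a-summand (2 ℕ.+ k) j
a-certificate-ratio k zero    = proportional (ℤ.*-zeroʳ ((+ 2 + + k) * (+ 2 + + k)))
a-certificate-ratio k (suc j) = proportional (begin
  s * s * (m * l * a-summand (suc k) j)         ≡⟨ regroup s m l _ ⟩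
  l * (m * (s * s) * a-summand (suc k) j)       ≡⟨ cong (l *_) (equation (a-summand-shift-diag (suc k) j)) ⟨
  l * (t * t * t * a-summand (2 ℕ.+ k) (suc j)) ≡⟨ regroup′ (+ j) (+ k) _ ⟩
  t * t * t * (+ 3 * t - + 4 * + k - + 8) * a-summand (2 ℕ.+ k) (suc j) ∎)
  where
  s t m l : ℤ
  s = + 2 + + k
  t = + 1 + + j
  m = + 2 * (+ 1 + + 2 * + j)
  l = + 3 * + j - + 4 * + k - + 5
  regroup : ∀ s m l f → s * s * (m * l * f) ≡ l * (m * (s * s) * f)
  regroup = solve-∀
  regroup′ : ∀ j k f → (+ 3 * j - + 4 * k - + 5) * ((+ 1 + j) * (+ 1 + j) * (+ 1 + j) * f)
                     ≡ (+ 1 + j) * (+ 1 + j) * (+ 1 + j) * (+ 3 * (+ 1 + j) - + 4 * k - + 8) * f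
  regroup′ = solve-∀

a-certificate-suc-ratio : ∀ k j → (+ 2 + + k) * (+ 2 + + k) · a-certificate k (suc j)
                            ≐ + 2 * (+ 1 + + 2 * + j) * (+ 3 * + j - + 4 * + k - + 5)
                              * ((+ 2 + + k - + j) * (+ 2 + + k - + j)) · a-summand (2 ℕ.+ k) j
a-certificate-suc-ratio k j = proportional (begin
  s * s * (m * a-summand (suc k) j)   ≡⟨ x∙yz≈y∙xz (s * s) m _ ⟩
  m * (s * s * a-summand (suc k) j)   ≡⟨ cong (m *_) (equation (a-summand-shiftₖ (suc k) j)) ⟩
  m * (t * t * a-summand (2 ℕ.+ k) j) ≡⟨ ℤ.*-assoc m (t * t) _ ⟨
  m * (t * t) * a-summand (2 ℕ.+ k) j ∎)
  where
  s t m : ℤ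
  s = + 2 + + k
  t = + 2 + + k - + j
  m = + 2 * (+ 1 + + 2 * + j) * (+ 3 * + j - + 4 * + k - + 5)

a₀ a₁ a₂ : ℕ → ℤ
a₀ k = + 9 * ((+ 1 + + k) * (+ 1 + + k))
a₁ k = - (+ 10 * ((+ 1 + + k) * (+ 1 + + k)) + + 10 * (+ 1 + + k) + + 3)
a₂ k = (+ 2 + + k) * (+ 2 + + k)

a-telescoping : ∀ k j → a₀ k * a-summand k j + a₁ k * a-summand (suc k) j + a₂ k * a-summand (2 ℕ.+ k) j
                      ≡ a-certificate k (suc j) - a-certificate k j
a-telescoping k j = combination-via-proportions (a₀ k) (a₁ k) (a₂ k)
  (≐-trans (a-summand-shiftₖ k j) (a-summand-shiftₖ (suc k) j))
  (≐-scale r (a-summand-shiftₖ (suc k) j))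
  ≐-refl
  (≐-scale r (a-certificate-ratio k j))
  (≐-scale r (a-certificate-suc-ratio k j))
  (certificate-identity (+ k) (+ j))
  where
  r : ℤ
  r = (+ 1 + + k) * (+ 1 + + k)
  certificate-identity : ∀ k j →
      + 9 * ((+ 1 + k) * (+ 1 + k)) * ((+ 1 + k - j) * (+ 1 + k - j) * ((+ 2 + k - j) * (+ 2 + k - j)))
    + - (+ 10 * ((+ 1 + k) * (+ 1 + k)) + + 10 * (+ 1 + k) + + 3) * ((+ 2 + k - j) * (+ 2 + k - j) * ((+ 1 + k) * (+ 1 + k)))
    + (+ 2 + k) * (+ 2 + k) * ((+ 2 + k) * (+ 2 + k) * ((+ 1 + k) * (+ 1 + k)))
    ≡ + 2 * (+ 1 + + 2 * j) * (+ 3 * j - + 4 * k - + 5) * ((+ 2 + k - j) * (+ 2 + k - j)) * ((+ 1 + k) * (+ 1 + k))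
    - j * j * j * (+ 3 * j - + 4 * k - + 8) * ((+ 1 + k) * (+ 1 + k))
  certificate-identity = solve-∀

a-summand-vanish : ∀ {k j} → k < j → a-summand k j ≡ 0ℤ
a-summand-vanish {k} {j} k<j = cong (λ b → b * b * binom (2 ℕ.* j) j) (binom-vanish k<j)

a-certificate-end : ∀ k → a-certificate k (3 ℕ.+ k) ≡ 0ℤ
a-certificate-end k = trans (cong (m *_) (a-summand-vanish (ℕ.n<1+n (suc k)))) (ℤ.*-zeroʳ m)
  where
  m : ℤ
  m = + 2 * (+ 1 + + 2 * + (2 ℕ.+ k)) * (+ 3 * + (2 ℕ.+ k) - + 4 * + k - + 5)

a-annihilated : Annihilates a₀ a₁ a₂ a
a-annihilated = creative-telescoping a₀ a₁ a₂ a-summand a-certificate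
  a-summand-vanish (λ _ → refl) a-certificate-end a-telescoping

-- At k = 0 the junk value a (0 ∸ 1) = a 0 is multiplied by 0.
a-recurrence : ∀ k → (+ 1 + + k) * (+ 1 + + k) * a (suc k)
                   ≡ (+ 10 * (+ k * + k) + + 10 * + k + + 3) * a k - + 9 * (+ k * + k) * a (k ∸ 1)
a-recurrence zero    = refl
a-recurrence (suc k) = begin
  (+ 2 + + k) * (+ 2 + + k) * a (2 ℕ.+ k)
    ≡⟨ isolate (+ k) (a k) (a (suc k)) (a (2 ℕ.+ k)) ⟩
  rhs + (a₀ k * a k + a₁ k * a (suc k) + a₂ k * a (2 ℕ.+ k))
    ≡⟨ cong (λ z → rhs + z) (a-annihilated k) ⟩
  rhs + 0ℤ
    ≡⟨ ℤ.+-identityʳ rhs ⟩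
  rhs ∎
  where
  rhs : ℤ
  rhs = (+ 10 * (+ suc k * + suc k) + + 10 * + suc k + + 3) * a (suc k) - + 9 * (+ suc k * + suc k) * a k
  isolate : ∀ k A₀ A₁ A₂ → (+ 2 + k) * (+ 2 + k) * A₂
          ≡ (+ 10 * ((+ 1 + k) * (+ 1 + k)) + + 10 * (+ 1 + k) + + 3) * A₁ - + 9 * ((+ 1 + k) * (+ 1 + k)) * A₀
            + (+ 9 * ((+ 1 + k) * (+ 1 + k)) * A₀
               + - (+ 10 * ((+ 1 + k) * (+ 1 + k)) + + 10 * (+ 1 + k) + + 3) * A₁
               + (+ 2 + k) * (+ 2 + k) * A₂)
  isolate = solve-∀

rhs-weight : ℕ → ℤ
rhs-weight k = central-binom k * central-binom k * binom (4 ℕ.* k) (2 ℕ.* k)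

rhs-weight-step : ∀ k → (+ 1 + + k) * (+ 1 + + k) * (+ 1 + + k) * (+ 1 + + k) · rhs-weight (suc k)
                      ≐ rising (+ 4 * + k) 4 · rhs-weight k
rhs-weight-step k = ≐-cancel (m * m) {{ℤ.i*j≢0 m m {{2[1+2k]≢0 k}} {{2[1+2k]≢0 k}}}}
  (≐-coeff (lhs-coefficient (+ k) (+ (2 ℕ.* k)) (+ (4 ℕ.* k)) (ℤ.pos-* 2 k) (ℤ.pos-* 4 k))
           (cong (λ t → m * m * rising t 4) (ℤ.pos-* 4 k))
           (≐-* (≐-* (central-binom-step k) (central-binom-step k)) binom-step))
  where
  m X : ℤ
  m = + 2 * (+ 1 + + 2 * + k)
  X = (+ 1 + + (2 ℕ.* k)) * (+ 2 + + (2 ℕ.* k))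
      * ((+ 1 + + (4 ℕ.* k) - + (2 ℕ.* k)) * (+ 2 + + (4 ℕ.* k) - + (2 ℕ.* k)))
  binom-step : X · binom (4 ℕ.* suc k) (2 ℕ.* suc k) ≐ rising (+ (4 ℕ.* k)) 4 · binom (4 ℕ.* k) (2 ℕ.* k)
  binom-step = subst (λ b → X · b ≐ rising (+ (4 ℕ.* k)) 4 · binom (4 ℕ.* k) (2 ℕ.* k))
                     (cong₂ binom (sym (ℕ.*-suc 4 k)) (sym (ℕ.*-suc 2 k)))
                     (binom-step₄₂ (4 ℕ.* k) (2 ℕ.* k))
  lhs-coefficient : ∀ k k₂ k₄ → k₂ ≡ + 2 * k → k₄ ≡ + 4 * k →
    (+ 1 + k) * (+ 1 + k) * ((+ 1 + k₂) * (+ 2 + k₂) * ((+ 1 + k₄ - k₂) * (+ 2 + k₄ - k₂)))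
    ≡ + 2 * (+ 1 + + 2 * k) * (+ 2 * (+ 1 + + 2 * k)) * ((+ 1 + k) * (+ 1 + k) * (+ 1 + k) * (+ 1 + k))
  lhs-coefficient k _ _ refl refl = expand k
    where
    expand : ∀ k → (+ 1 + k) * (+ 1 + k)
                   * ((+ 1 + + 2 * k) * (+ 2 + + 2 * k) * ((+ 1 + + 4 * k - + 2 * k) * (+ 2 + + 4 * k - + 2 * k)))
                 ≡ + 2 * (+ 1 + + 2 * k) * (+ 2 * (+ 1 + + 2 * k)) * ((+ 1 + k) * (+ 1 + k) * (+ 1 + k) * (+ 1 + k))
    expand = solve-∀

rhs-term : ℕ → ℕ → ℤ
rhs-term = term rhs-weight 3 (- + 27)

rhs-term-shiftₙ : ∀ n k → - + 27 * (+ 1 + + n + + 3 * + k) · rhs-term n k ≐ (+ suc n - + k) · rhs-term (suc n) k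
rhs-term-shiftₙ = term-shiftₙ rhs-weight 3 (- + 27)

rhs-term-shift-diag : ∀ n k → (+ 1 + + k) * (+ 1 + + k) * (+ 1 + + k) * (+ 1 + + k) · rhs-term (suc n) (suc k)
                            ≐ rising (+ n + + 3 * + k) 4 · rhs-term n k
rhs-term-shift-diag n k =
  ≐-cancel (rising (+ 4 * + k) 4) {{R≢0}} (term-shift-diag rhs-weight 3 (- + 27) n k (rhs-weight-step k))
  where
  R≢0 : NonZero (rising (+ 4 * + k) 4)
  R≢0 = subst (λ t → NonZero (rising t 4)) (ℤ.pos-* 4 k) _

rhs-certificate : ℕ → ℕ → ℤ
rhs-certificate n zero    = 0ℤ
rhs-certificate n (suc k) =
  - + 4 * (+ 7 + + 4 * + n) * ((+ 2 + + n + + 3 * + k) * (+ 3 + + n + + 3 * + k)) * rhs-term (suc n) k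

rhs-certificate-ratio : ∀ n k → (+ 1 + + n + + 3 * + k) * (+ 2 + + n + + 3 * + k) · rhs-certificate n k
                              ≐ - + 4 * (+ k * + k * + k * + k) * (+ 7 + + 4 * + n) · rhs-term (2 ℕ.+ n) k
rhs-certificate-ratio n zero    = proportional (ℤ.*-zeroʳ ((+ 1 + + n + + 3 * + 0) * (+ 2 + + n + + 3 * + 0)))
rhs-certificate-ratio n (suc j) = proportional (begin
  (+ 1 + N + + 3 * (+ 1 + J)) * (+ 2 + N + + 3 * (+ 1 + J)) * (g * rhs-term (suc n) j)
    ≡⟨ regroup N J (rhs-term (suc n) j) ⟩
  l * (rising (+ suc n + + 3 * J) 4 * rhs-term (suc n) j)
    ≡⟨ cong (l *_) (equation (rhs-term-shift-diag (suc n) j)) ⟨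
  l * ((+ 1 + J) * (+ 1 + J) * (+ 1 + J) * (+ 1 + J) * rhs-term (2 ℕ.+ n) (suc j))
    ≡⟨ regroup′ N J (rhs-term (2 ℕ.+ n) (suc j)) ⟩
  - + 4 * ((+ 1 + J) * (+ 1 + J) * (+ 1 + J) * (+ 1 + J)) * (+ 7 + + 4 * N) * rhs-term (2 ℕ.+ n) (suc j) ∎)
  where
  N J l g : ℤ
  N = + n
  J = + j
  l = - + 4 * (+ 7 + + 4 * N)
  g = l * ((+ 2 + N + + 3 * J) * (+ 3 + N + + 3 * J))
  regroup : ∀ N J F → (+ 1 + N + + 3 * (+ 1 + J)) * (+ 2 + N + + 3 * (+ 1 + J))
                        * (- + 4 * (+ 7 + + 4 * N) * ((+ 2 + N + + 3 * J) * (+ 3 + N + + 3 * J)) * F)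
                    ≡ - + 4 * (+ 7 + + 4 * N)
                        * (+ 1 * (+ 1 + (+ 1 + N + + 3 * J)) * (+ 2 + (+ 1 + N + + 3 * J))
                             * (+ 3 + (+ 1 + N + + 3 * J)) * (+ 4 + (+ 1 + N + + 3 * J)) * F)
  regroup = solve-∀
  regroup′ : ∀ N J F → - + 4 * (+ 7 + + 4 * N) * ((+ 1 + J) * (+ 1 + J) * (+ 1 + J) * (+ 1 + J) * F)
                     ≡ - + 4 * ((+ 1 + J) * (+ 1 + J) * (+ 1 + J) * (+ 1 + J)) * (+ 7 + + 4 * N) * F
  regroup′ = solve-∀

r₀ r₁ r₂ : ℕ → ℤ
r₀ n = + 81 * ((+ 1 + + n) * (+ 1 + + n) * (+ 1 + + n))
r₁ n = + 51 + + 97 * + n + + 63 * (+ n * + n) + + 14 * (+ n * + n * + n)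
r₂ n = (+ 2 + + n) * (+ 2 + + n) * (+ 2 + + n)

rhs-telescoping : ∀ n k → r₀ n * rhs-term n k + r₁ n * rhs-term (suc n) k + r₂ n * rhs-term (2 ℕ.+ n) k
                        ≡ rhs-certificate n (suc k) - rhs-certificate n k
rhs-telescoping n k = combination-via-proportions {{d≢0}} (r₀ n) (r₁ n) (r₂ n)
  (≐-trans (rhs-term-shiftₙ n k) (rhs-term-shiftₙ (suc n) k))
  (≐-scale p (rhs-term-shiftₙ (suc n) k))
  ≐-refl
  (≐-coeff (common-factor (+ n) (+ k)) refl (≐-scale (+ 729) (rhs-certificate-ratio n k)))
  (≐-*ˡ g (≐-scale p (rhs-term-shiftₙ (suc n) k)))
  (certificate-identity (+ n) (+ k))
  where
  p g : ℤ
  p = - + 27 * (+ 1 + + n + + 3 * + k)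
  g = - + 4 * (+ 7 + + 4 * + n) * ((+ 2 + + n + + 3 * + k) * (+ 3 + + n + + 3 * + k))
  d≢0 : NonZero (- + 27 * (+ 1 + + suc n + + 3 * + k) * p)
  d≢0 = subst NonZero (cong (λ a → - + 27 * (+ 1 + + suc n + a) * (- + 27 * (+ 1 + + n + a))) (ℤ.pos-* 3 k)) _
  common-factor : ∀ n k → (+ 1 + n + + 3 * k) * (+ 2 + n + + 3 * k) * + 729
                        ≡ - + 27 * (+ 1 + (+ 1 + n) + + 3 * k) * (- + 27 * (+ 1 + n + + 3 * k))
  common-factor = solve-∀
  certificate-identity : ∀ n k →
      + 81 * ((+ 1 + n) * (+ 1 + n) * (+ 1 + n)) * ((+ 1 + n - k) * (+ 2 + n - k))
    + (+ 51 + + 97 * n + + 63 * (n * n) + + 14 * (n * n * n)) * ((+ 2 + n - k) * (- + 27 * (+ 1 + n + + 3 * k)))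
    + (+ 2 + n) * (+ 2 + n) * (+ 2 + n) * (- + 27 * (+ 1 + (+ 1 + n) + + 3 * k) * (- + 27 * (+ 1 + n + + 3 * k)))
    ≡ - + 4 * (+ 7 + + 4 * n) * ((+ 2 + n + + 3 * k) * (+ 3 + n + + 3 * k))
        * ((+ 2 + n - k) * (- + 27 * (+ 1 + n + + 3 * k)))
    - - + 4 * (k * k * k * k) * (+ 7 + + 4 * n) * + 729
  certificate-identity = solve-∀

rhs-certificate-end : ∀ n → rhs-certificate n (3 ℕ.+ n) ≡ 0ℤ
rhs-certificate-end n = trans (cong (g *_) (term-vanish rhs-weight 3 (- + 27) (ℕ.n<1+n (suc n)))) (ℤ.*-zeroʳ g)
  where
  g : ℤ
  g = - + 4 * (+ 7 + + 4 * + n) * ((+ 2 + + n + + 3 * + (2 ℕ.+ n)) * (+ 3 + + n + + 3 * + (2 ℕ.+ n)))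

rhs-sum : ℕ → ℤ
rhs-sum n = sumTo n (rhs-term n)

rhs-annihilated : Annihilates r₀ r₁ r₂ rhs-sum
rhs-annihilated = creative-telescoping r₀ r₁ r₂ rhs-term rhs-certificate
  (term-vanish rhs-weight 3 (- + 27)) (λ _ → refl) rhs-certificate-end rhs-telescoping

lhs-term : ℕ → ℕ → ℤ
lhs-term = term central-binom 1 (- + 9)

lhs-term-shiftₙ : ∀ n k → - + 9 * (+ 1 + + n + + 1 * + k) · lhs-term n k ≐ (+ suc n - + k) · lhs-term (suc n) k
lhs-term-shiftₙ = term-shiftₙ central-binom 1 (- + 9)

lhs-term-shift-diag : ∀ n k → (+ 1 + + k) * (+ 1 + + k) · lhs-term (suc n) (suc k)
                            ≐ (+ 1 + + n + + k) * (+ 2 + + n + + k) · lhs-term n k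
lhs-term-shift-diag n k = ≐-cancel (+ 2 * (+ 1 + + 2 * + k)) {{2[1+2k]≢0 k}}
  (≐-coeff (lhs-factor (+ k)) (rhs-factor (+ n) (+ k))
    (term-shift-diag central-binom 1 (- + 9) n k (central-binom-step k)))
  where
  lhs-factor : ∀ k → + 1 * (+ 1 + + 2 * k) * (+ 2 + + 2 * k) * (+ 1 + k)
                   ≡ + 2 * (+ 1 + + 2 * k) * ((+ 1 + k) * (+ 1 + k))
  lhs-factor = solve-∀
  rhs-factor : ∀ n k → + 2 * (+ 1 + + 2 * k) * (+ 1 * (+ 1 + (n + + 1 * k)) * (+ 2 + (n + + 1 * k)))
                     ≡ + 2 * (+ 1 + + 2 * k) * ((+ 1 + n + k) * (+ 2 + n + k))
  rhs-factor = solve-∀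

lhs-certificate : ℕ → ℕ → ℤ
lhs-certificate n zero    = 0ℤ
lhs-certificate n (suc k) =
  + 2 * (+ 3 + + 2 * + n) * lhs-term (suc n) k
    * (- ((+ 1 + + k) * (+ 1 + + k) * a (suc k)) + (+ k - (+ 1 + + n)) * (+ 2 + + k + + n) * a k)

lhs-certificate-ratio : ∀ n k → (+ 1 + + n + + k) * (+ 2 + + n + + k) · lhs-certificate n k
                              ≐ + 2 * (+ k * + k) * (+ 3 + + 2 * + n)
                                * (- (+ k * + k * a k) + (+ k - (+ 2 + + n)) * (+ 1 + + k + + n) * a (k ∸ 1))
                              · lhs-term (2 ℕ.+ n) k
lhs-certificate-ratio n zero    = proportional (ℤ.*-zeroʳ ((+ 1 + + n + + 0) * (+ 2 + + n + + 0)))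
lhs-certificate-ratio n (suc j) = proportional (begin
  (+ 1 + N + (+ 1 + J)) * (+ 2 + N + (+ 1 + J)) * (γ * lhs-term (suc n) j * A)
    ≡⟨ regroup N J γ A (lhs-term (suc n) j) ⟩
  γ * A * ((+ 1 + (+ 1 + N) + J) * (+ 2 + (+ 1 + N) + J) * lhs-term (suc n) j)
    ≡⟨ cong (γ * A *_) (equation (lhs-term-shift-diag (suc n) j)) ⟨
  γ * A * ((+ 1 + J) * (+ 1 + J) * lhs-term (2 ℕ.+ n) (suc j))
    ≡⟨ regroup′ N J (a (suc j)) (a j) (lhs-term (2 ℕ.+ n) (suc j)) ⟩
  + 2 * ((+ 1 + J) * (+ 1 + J)) * (+ 3 + + 2 * N)
    * (- ((+ 1 + J) * (+ 1 + J) * a (suc j)) + ((+ 1 + J) - (+ 2 + N)) * (+ 1 + (+ 1 + J) + N) * a j)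
    * lhs-term (2 ℕ.+ n) (suc j) ∎)
  where
  N J γ A : ℤ
  N = + n
  J = + j
  γ = + 2 * (+ 3 + + 2 * N)
  A = - ((+ 1 + J) * (+ 1 + J) * a (suc j)) + (J - (+ 1 + N)) * (+ 2 + J + N) * a j
  regroup : ∀ N J γ A w → (+ 1 + N + (+ 1 + J)) * (+ 2 + N + (+ 1 + J)) * (γ * w * A)
                        ≡ γ * A * ((+ 1 + (+ 1 + N) + J) * (+ 2 + (+ 1 + N) + J) * w)
  regroup = solve-∀
  regroup′ : ∀ N J A₁ A₀ w →
      + 2 * (+ 3 + + 2 * N) * (- ((+ 1 + J) * (+ 1 + J) * A₁) + (J - (+ 1 + N)) * (+ 2 + J + N) * A₀)
        * ((+ 1 + J) * (+ 1 + J) * w)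
    ≡ + 2 * ((+ 1 + J) * (+ 1 + J)) * (+ 3 + + 2 * N)
        * (- ((+ 1 + J) * (+ 1 + J) * A₁) + ((+ 1 + J) - (+ 2 + N)) * (+ 1 + (+ 1 + J) + N) * A₀)
        * w
  regroup′ = solve-∀

lhs-telescoping : ∀ n k → r₀ n * (lhs-term n k * a k) + r₁ n * (lhs-term (suc n) k * a k)
                          + r₂ n * (lhs-term (2 ℕ.+ n) k * a k)
                        ≡ lhs-certificate n (suc k) - lhs-certificate n k
lhs-telescoping n k = combination-via-proportions {{d≢0}} (r₀ n) (r₁ n) (r₂ n)
  (≐-*ʳ (a k) (≐-trans (lhs-term-shiftₙ n k) (lhs-term-shiftₙ (suc n) k)))
  (≐-*ʳ (a k) (≐-scale p (lhs-term-shiftₙ (suc n) k)))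
  (≐-*ʳ (a k) ≐-refl)
  (≐-coeff (common-factor (+ n) (+ k)) refl (≐-scale (+ 81) (lhs-certificate-ratio n k)))
  -- a (suc k) in the certificate is eliminated with a-recurrence, leaving an identity in a k and a (k ∸ 1).
  (≐-coeff refl (cong (λ t → γ * q * (- t + (+ k - (+ 1 + + n)) * (+ 2 + + k + + n) * a k)) (a-recurrence k))
    (≐-*ʳ A (≐-*ˡ γ (≐-scale p (lhs-term-shiftₙ (suc n) k)))))
  (certificate-identity (+ n) (+ k) (a (k ∸ 1)) (a k))
  where
  p q γ A : ℤ
  p = - + 9 * (+ 1 + + n + + 1 * + k)
  q = (+ 2 + + n - + k) * p
  γ = + 2 * (+ 3 + + 2 * + n)
  A = - ((+ 1 + + k) * (+ 1 + + k) * a (suc k)) + (+ k - (+ 1 + + n)) * (+ 2 + + k + + n) * a k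
  d≢0 : NonZero (- + 9 * (+ 1 + + suc n + + 1 * + k) * p)
  d≢0 = subst NonZero (cong (λ t → - + 9 * (+ 1 + + suc n + t) * (- + 9 * (+ 1 + + n + t))) (ℤ.pos-* 1 k)) _
  common-factor : ∀ n k → (+ 1 + n + k) * (+ 2 + n + k) * + 81
                        ≡ - + 9 * (+ 1 + (+ 1 + n) + + 1 * k) * (- + 9 * (+ 1 + n + + 1 * k))
  common-factor = solve-∀
  certificate-identity : ∀ n k A₀ A₁ →
      + 81 * ((+ 1 + n) * (+ 1 + n) * (+ 1 + n)) * ((+ 1 + n - k) * (+ 2 + n - k) * A₁)
    + (+ 51 + + 97 * n + + 63 * (n * n) + + 14 * (n * n * n)) * ((+ 2 + n - k) * (- + 9 * (+ 1 + n + + 1 * k)) * A₁)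
    + (+ 2 + n) * (+ 2 + n) * (+ 2 + n)
      * (- + 9 * (+ 1 + (+ 1 + n) + + 1 * k) * (- + 9 * (+ 1 + n + + 1 * k)) * A₁)
    ≡ + 2 * (+ 3 + + 2 * n) * ((+ 2 + n - k) * (- + 9 * (+ 1 + n + + 1 * k)))
        * (- ((+ 10 * (k * k) + + 10 * k + + 3) * A₁ - + 9 * (k * k) * A₀) + (k - (+ 1 + n)) * (+ 2 + k + n) * A₁)
    - + 2 * (k * k) * (+ 3 + + 2 * n) * (- (k * k * A₁) + (k - (+ 2 + n)) * (+ 1 + k + n) * A₀) * + 81
  certificate-identity = solve-∀

lhs-certificate-end : ∀ n → lhs-certificate n (3 ℕ.+ n) ≡ 0ℤ
lhs-certificate-end n = begin
  γ * lhs-term (suc n) (2 ℕ.+ n) * A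
    ≡⟨ cong (λ t → γ * t * A) (term-vanish central-binom 1 (- + 9) (ℕ.n<1+n (suc n))) ⟩
  γ * 0ℤ * A
    ≡⟨ cong (_* A) (ℤ.*-zeroʳ γ) ⟩
  0ℤ * A
    ≡⟨ ℤ.*-zeroˡ A ⟩
  0ℤ ∎
  where
  γ A : ℤ
  γ = + 2 * (+ 3 + + 2 * + n)
  A = - ((+ 1 + + (2 ℕ.+ n)) * (+ 1 + + (2 ℕ.+ n)) * a (3 ℕ.+ n))
      + (+ (2 ℕ.+ n) - (+ 1 + + n)) * (+ 2 + + (2 ℕ.+ n) + + n) * a (2 ℕ.+ n)

lhs-sum : ℕ → ℤ
lhs-sum n = sumTo n (λ k → lhs-term n k * a k)

lhs-annihilated : Annihilates r₀ r₁ r₂ lhs-sum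
lhs-annihilated = creative-telescoping r₀ r₁ r₂ (λ n k → lhs-term n k * a k) lhs-certificate
  (λ {n} {k} n<k → trans (cong (_* a k) (term-vanish central-binom 1 (- + 9) n<k)) (ℤ.*-zeroˡ (a k)))
  (λ _ → refl) lhs-certificate-end lhs-telescoping

lemma4p1 : (n : ℕ) → sumTo n (λ k → binom (2 Data.Nat.* k) k * binom (n Data.Nat.+ k) (2 Data.Nat.* k) * ((- + 9) ^ (n ∸ k)) * a k) ≡ sumTo n (λ k → binom (2 Data.Nat.* k) k * binom (2 Data.Nat.* k) k * binom (4 Data.Nat.* k) (2 Data.Nat.* k) * binom (n Data.Nat.+ 3 Data.Nat.* k) (4 Data.Nat.* k) * ((- + 27) ^ (n ∸ k)))
lemma4p1 n = begin
  sumTo n (λ k → binom (2 ℕ.* k) k * binom (n ℕ.+ k) (2 ℕ.* k) * (- + 9) ^ (n ∸ k) * a k)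
    ≡⟨ sumTo-cong n (λ k → cong (λ m → binom (2 ℕ.* k) k * binom (n ℕ.+ m) (2 ℕ.* k) * (- + 9) ^ (n ∸ k) * a k)
                                (sym (ℕ.*-identityˡ k))) ⟩
  lhs-sum n
    ≡⟨ annihilated-unique r₀ r₁ r₂ lhs-sum rhs-sum (λ _ → _) lhs-annihilated rhs-annihilated refl refl n ⟩
  rhs-sum n ∎
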